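{- Let $G$ be a partial cube. Then ${\rm fdim}(G)\le {\rm idim}(G)+{\rm ldim}(G)-1$.
   Context: All graphs are finite. The $d$-cube $Q_d$ has vertex set $\{0,1\}^d$, two vertices adjacent iff they differ in exactly one coordinate. A Fibonacci string is a binary string with no two consecutive $1$s; the Fibonacci cube $\Gamma_d$ is the subgraph of $Q_d$ induced by the Fibonacci strings of length $d$. An isometric embedding is an injective map preserving shortest-path distances. A partial cube is a graph that isometrically embeds into some hypercube. $\mathbb{Z}^\ell$ is regarded as the infinite graph in which two points are adjacent iff their $L_1$-distance is $1$ (so its graph distance is the $L_1$-distance). ${\rm idim}(G)$, ${\rm fdim}(G)$, ${\rm ldim}(G)$ are the least integers $k$ such that $G$ isometrically embeds into $Q_k$, $\Gamma_k$, $\mathbb{Z}^k$ respectively. -}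

module Defs where

open import Data.Nat using (ℕ; zero; suc; _+_; _∸_; _≤_)
open import Data.Integer as ℤ using (ℤ; ∣_∣; _-_)
open import Data.Bool using (Bool; true; false; T)
open import Data.Fin using (Fin)
open import Data.Vec using (Vec; []; _∷_; lookup; zipWith; foldr)
open import Data.Product using (Σ; ∃; ∃-syntax; _×_; _,_)
open import Relation.Binary.PropositionalEquality using (_≡_; _≢_)
open import Relation.Nullary using (¬_)
open import Function.Bundles using (_⇔_)
open import Function.Definitions using (Injective)

record Graph : Set₁ where
  field
    V : Set
    E : V → V → Set
open Graph public

data Walk (G : Graph) : V G → V G → ℕ → Set where
  nil  : (u : V G) → Walk G u u 0
  cons : {u w v : V G} {k : ℕ} → E G u w → Walk G w v k → Walk G u v (suc k)

Dist : (G : Graph) → V G → V G → ℕ → Set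
Dist G u v k = Walk G u v k × (∀ m → Walk G u v m → k ≤ m)

IsometricEmbedding : (G H : Graph) → (V G → V H) → Set
IsometricEmbedding G H f =
  Injective _≡_ _≡_ f × (∀ u v k → Dist G u v k ⇔ Dist H (f u) (f v) k)

EmbedsInto : Graph → Graph → Set
EmbedsInto G H = Σ (V G → V H) (IsometricEmbedding G H)

record FiniteSimpleGraph : Set where
  field
    n     : ℕ
    adj   : Fin n → Fin n → Bool
    sym   : ∀ u v → adj u v ≡ adj v u
    irrefl : ∀ u → adj u u ≡ false
open FiniteSimpleGraph public

toGraph : FiniteSimpleGraph → Graph
toGraph G = record { V = Fin (n G) ; E = λ u v → T (adj G u v) }

HypercubeAdj : {d : ℕ} → Vec Bool d → Vec Bool d → Set
HypercubeAdj {d} x y =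
  ∃[ i ] (lookup x i ≢ lookup y i × (∀ (j : Fin d) → j ≢ i → lookup x j ≡ lookup y j))

Q : ℕ → Graph
Q d = record { V = Vec Bool d ; E = HypercubeAdj }

isFib : {d : ℕ} → Vec Bool d → Bool
isFib [] = true
isFib (_ ∷ []) = true
isFib (true ∷ true ∷ _) = false
isFib (_ ∷ y ∷ xs) = isFib (y ∷ xs)

FibString : ℕ → Set
FibString d = Σ (Vec Bool d) (λ x → T (isFib x))

Γ : ℕ → Graph
Γ d = record { V = FibString d ; E = λ x y → HypercubeAdj (Data.Product.proj₁ x) (Data.Product.proj₁ y) }

l1 : {ℓ : ℕ} → Vec ℤ ℓ → Vec ℤ ℓ → ℕ
l1 x y = foldr _ _+_ 0 (zipWith (λ a b → ∣ a - b ∣) x y)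

ZZ : ℕ → Graph
ZZ ℓ = record { V = Vec ℤ ℓ ; E = λ x y → l1 x y ≡ 1 }

IsPartialCube : Graph → Set
IsPartialCube G = ∃[ d ] EmbedsInto G (Q d)

IsLeast : (ℕ → Set) → ℕ → Set
IsLeast P k = P k × (∀ m → P m → k ≤ m)

IsIdim IsFdim IsLdim : Graph → ℕ → Set
IsIdim G = IsLeast (λ k → EmbedsInto G (Q k))
IsFdim G = IsLeast (λ k → EmbedsInto G (Γ k))
IsLdim G = IsLeast (λ k → EmbedsInto G (ZZ k))

module Submission where

-- Fix isometric embeddings h : G → Q_i and g : G → ℤ^ℓ.  Translating g so that each
-- coordinate has minimum 0 gives P : G → ℕ^ℓ whose image lies in a box Π [0, aₖ] with
-- every value 0 … aₖ attained.  For each slot (k, s) with s < aₖ, a geodesic from the lowest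
-- to the highest vertex in coordinate k contains an edge xy stepping from level s to 1 + s
-- ("crossing").  Since h and P induce the same distances, the halfspace {P_k ≤ s} is exactly
-- {w : h(w)_j = h(x)_j} for the hypercube coordinate j flipped along xy; hence distinct slots
-- flip distinct coordinates and Σ aₖ ≤ i.  The box embeds isometrically into the Fibonacci
-- cube Γ_{Σaₖ+ℓ-1} (reflected path codes joined by single 0s), so G embeds into Γ_m with
-- m ≤ i + ℓ - 1.  Finally, embeddability into Γ_m is decidable for finite G, so the least such
-- m exists, and it is at most i + ℓ - 1.

open import Defs hiding (sym)
open import Data.Nat using (ℕ; _+_; _∸_; _≤_)
open import Data.Product using (Σ; _×_)
open import Data.Nat using (zero; suc; _<_; z≤n; s≤s; ∣_-_∣)
import Data.Nat.Properties as NP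
open import Data.Nat.Tactic.RingSolver using (solve-∀)
open import Data.Integer as Z using (ℤ)
import Data.Integer.Properties as ZP
open import Data.Integer.Tactic.RingSolver renaming (solve-∀ to ℤ-solve-∀)
open import Data.Bool using (Bool; true; false; T)
import Data.Bool.Properties as BP
open import Data.Unit using (tt)
open import Data.Empty using (⊥; ⊥-elim)
open import Data.Fin as F using (Fin)
import Data.Fin.Properties as FP
open import Data.Fin.Subset.Properties using (anySubset?)
open import Data.Vec as V using (Vec; []; _∷_; lookup)
open import Data.Vec.Properties using (lookup∘tabulate)
open import Data.List using (allFin)
open import Data.List.Membership.Propositional.Properties using (∈-allFin)
import Data.List.Relation.Unary.All as All
import Data.List.Extrema ZP.≤-totalOrder as ℤ-Extrema
import Data.List.Extrema NP.≤-totalOrder as ℕ-Extrema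
open import Data.Product using (proj₁; proj₂; _,_)
open import Data.Sum using (_⊎_; inj₁; inj₂)
import Data.Sum
open import Relation.Binary.PropositionalEquality
open import Relation.Nullary using (¬_; Dec; yes; no)
open import Relation.Nullary.Decidable using (T?; _×-dec_; map′)
open import Function.Bundles using (_⇔_; mk⇔; Equivalence)
open import Function.Definitions using (Injective)

+-cancel-suc : ∀ p q a → p + a ≡ q + suc a → p ≡ suc q
+-cancel-suc p q a e = NP.+-cancelʳ-≡ a p (suc q) (trans e (NP.+-suc q a))

not-mutual-successors : ∀ {p q} → p ≡ suc q → q ≡ suc p → ⊥
not-mutual-successors p≡1+q q≡1+p =
  NP.<-asym (NP.≤-reflexive (sym q≡1+p)) (NP.≤-reflexive (sym p≡1+q))

+≡1 : ∀ p q → p + q ≡ 1 → (p ≡ 0 × q ≡ 1) ⊎ (p ≡ 1 × q ≡ 0)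
+≡1 zero q e = inj₁ (refl , e)
+≡1 (suc zero) q e = inj₂ (refl , NP.suc-injective e)
+≡1 (suc (suc p)) q ()

threshold : ∀ s t → ¬ ((s ≤ t) ⇔ (suc s ≤ t)) → s ≡ t
threshold s t separated with s NP.≤? t | suc s NP.≤? t
... | yes s≤t | yes 1+s≤t = ⊥-elim (separated (mk⇔ (λ _ → 1+s≤t) (λ _ → s≤t)))
... | no s≰t  | no 1+s≰t  = ⊥-elim (separated (mk⇔ (λ p → ⊥-elim (s≰t p)) (λ p → ⊥-elim (1+s≰t p))))
... | yes s≤t | no 1+s≰t  = NP.≤-antisym s≤t (NP.≤-pred (NP.≰⇒> 1+s≰t))
... | no s≰t  | yes 1+s≤t = ⊥-elim (s≰t (NP.<⇒≤ 1+s≤t))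

squeeze : ∀ a b s → a ≤ s → s < b → ∣ a - b ∣ ≤ 1 → a ≡ s × b ≡ suc s
squeeze a b s a≤s s<b close = NP.≤-antisym a≤s s≤a , NP.≤-antisym (NP.≤-trans b≤1+a (s≤s a≤s)) s<b
  where
  b≤1+a : b ≤ suc a
  b≤1+a = NP.≤-trans (NP.m≤n+∣n-m∣ b a) (NP.≤-trans (NP.+-monoʳ-≤ a close) (NP.≤-reflexive (NP.+-comm a 1)))
  s≤a : s ≤ a
  s≤a = NP.≤-pred (NP.≤-trans s<b b≤1+a)

bool-others-agree : ∀ {a b c : Bool} → a ≢ c → b ≢ c → a ≡ b
bool-others-agree a≢c b≢c = trans (BP.¬-not a≢c) (sym (BP.¬-not b≢c))

vec-ext : ∀ {A : Set} {m} (x y : Vec A m) → (∀ j → lookup x j ≡ lookup y j) → x ≡ y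
vec-ext [] [] _ = refl
vec-ext (a ∷ x) (b ∷ y) h = cong₂ _∷_ (h F.zero) (vec-ext x y (λ j → h (F.suc j)))

-- Given a "metric" d on A (zero exactly on the diagonal), δ x y = Σ_j d x_j y_j on Vec A m.
-- This is the ℓ¹ (Hamming, L₁) distance underlying Q_d, Γ_d and ℤ^ℓ.
module SumMetric {A : Set} (d : A → A → ℕ) (d-refl : ∀ a → d a a ≡ 0)
                 (d-zero : ∀ a b → d a b ≡ 0 → a ≡ b) where

  δ : ∀ {m} → Vec A m → Vec A m → ℕ
  δ [] [] = 0
  δ (a ∷ x) (b ∷ y) = d a b + δ x y

  δ-refl : ∀ {m} (x : Vec A m) → δ x x ≡ 0
  δ-refl [] = refl
  δ-refl (a ∷ x) = cong₂ _+_ (d-refl a) (δ-refl x)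

  δ-zero : ∀ {m} (x y : Vec A m) → δ x y ≡ 0 → x ≡ y
  δ-zero [] [] _ = refl
  δ-zero (a ∷ x) (b ∷ y) e =
    cong₂ _∷_ (d-zero a b (NP.m+n≡0⇒m≡0 (d a b) e)) (δ-zero x y (NP.m+n≡0⇒n≡0 (d a b) e))

  AgreeOff : ∀ {m} → Fin m → Vec A m → Vec A m → Set
  AgreeOff k x y = ∀ j → j ≢ k → lookup x j ≡ lookup y j

  differing-coordinate : ∀ {m} (x y : Vec A m) {k} → δ x y ≡ suc k →
                         Σ (Fin m) λ j → lookup x j ≢ lookup y j
  differing-coordinate [] [] ()
  differing-coordinate (a ∷ x) (b ∷ y) e with d a b in dab
  ... | zero = let (j , x≢y) = differing-coordinate x y e in F.suc j , x≢y
  ... | suc _ = F.zero , λ a≡b → NP.0≢1+n (trans (sym (d-refl a)) (trans (cong (d a) a≡b) dab))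

  coordinate≤ : ∀ {m} (x y : Vec A m) k → d (lookup x k) (lookup y k) ≤ δ x y
  coordinate≤ (a ∷ x) (b ∷ y) F.zero = NP.m≤m+n (d a b) (δ x y)
  coordinate≤ (a ∷ x) (b ∷ y) (F.suc k) = NP.≤-trans (coordinate≤ x y k) (NP.m≤n+m (δ x y) (d a b))

  private
    differ⇒δ≢0 : ∀ {m} (x y : Vec A m) k → lookup x k ≢ lookup y k → δ x y ≢ 0
    differ⇒δ≢0 x y k x≢y δ≡0 = x≢y (cong (λ z → lookup z k) (δ-zero x y δ≡0))

  unit-distance-agree : ∀ {m} (x y : Vec A m) k → δ x y ≡ 1 → lookup x k ≢ lookup y k → AgreeOff k x y
  unit-distance-agree (a ∷ x) (b ∷ y) F.zero e a≢b F.zero j≢k = ⊥-elim (j≢k refl)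
  unit-distance-agree (a ∷ x) (b ∷ y) F.zero e a≢b (F.suc j) j≢k with +≡1 (d a b) (δ x y) e
  ... | inj₁ (dab≡0 , _) = ⊥-elim (a≢b (d-zero a b dab≡0))
  ... | inj₂ (_ , δ≡0) = cong (λ z → lookup z j) (δ-zero x y δ≡0)
  unit-distance-agree (a ∷ x) (b ∷ y) (F.suc k) e x≢y j j≢k with +≡1 (d a b) (δ x y) e | j
  ... | inj₂ (_ , δ≡0)   | _        = ⊥-elim (differ⇒δ≢0 x y k x≢y δ≡0)
  ... | inj₁ (dab≡0 , _) | F.zero   = d-zero a b dab≡0
  ... | inj₁ (_ , δ≡1)   | F.suc j' = unit-distance-agree x y k δ≡1 x≢y j' (λ j'≡k → j≢k (cong F.suc j'≡k))

  exchange : ∀ {m} (w x y : Vec A m) k → AgreeOff k x y →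
             δ w y + d (lookup w k) (lookup x k) ≡ δ w x + d (lookup w k) (lookup y k)
  exchange (c ∷ w) (a ∷ x) (b ∷ y) F.zero agree
    rewrite vec-ext x y (λ j → agree (F.suc j) (λ ())) = rearrange (d c b) (δ w y) (d c a)
    where
    rearrange : ∀ p q r → (p + q) + r ≡ (r + q) + p
    rearrange = solve-∀
  exchange (c ∷ w) (a ∷ x) (b ∷ y) (F.suc k) agree rewrite agree F.zero (λ ()) = begin
    (d c b + δ w y) + d (lookup w k) (lookup x k)   ≡⟨ NP.+-assoc (d c b) (δ w y) _ ⟩
    d c b + (δ w y + d (lookup w k) (lookup x k))   ≡⟨ cong (d c b +_) (exchange w x y k agree-tail) ⟩
    d c b + (δ w x + d (lookup w k) (lookup y k))   ≡⟨ NP.+-assoc (d c b) (δ w x) _ ⟨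
    (d c b + δ w x) + d (lookup w k) (lookup y k)   ∎
    where
    open ≡-Reasoning
    agree-tail : AgreeOff k x y
    agree-tail j j≢k = agree (F.suc j) (λ sj≡sk → j≢k (FP.suc-injective sj≡sk))

  agree-off-distance : ∀ {m} (x y : Vec A m) k → AgreeOff k x y → δ x y ≡ d (lookup x k) (lookup y k)
  agree-off-distance x y k agree = begin
    δ x y                                           ≡⟨ NP.+-identityʳ (δ x y) ⟨
    δ x y + 0                                       ≡⟨ cong (δ x y +_) (d-refl (lookup x k)) ⟨
    δ x y + d (lookup x k) (lookup x k)             ≡⟨ exchange x x y k agree ⟩
    δ x x + d (lookup x k) (lookup y k)             ≡⟨ cong (_+ d (lookup x k) (lookup y k)) (δ-refl x) ⟩
    d (lookup x k) (lookup y k)                     ∎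
    where open ≡-Reasoning

  nearer : ∀ {m} (w x y : Vec A m) k → AgreeOff k x y →
           d (lookup w k) (lookup y k) ≡ suc (d (lookup w k) (lookup x k)) → δ w y ≡ suc (δ w x)
  nearer w x y k agree step =
    +-cancel-suc (δ w y) (δ w x) _ (trans (exchange w x y k agree) (cong (δ w x +_) step))

  δ-triangle : (∀ a b c → d a c ≤ d a b + d b c) → ∀ {m} (x y z : Vec A m) → δ x z ≤ δ x y + δ y z
  δ-triangle d-tri [] [] [] = z≤n
  δ-triangle d-tri (a ∷ x) (b ∷ y) (c ∷ z) =
    NP.≤-trans (NP.+-mono-≤ (d-tri a b c) (δ-triangle d-tri x y z))
               (NP.≤-reflexive (interchange (d a b) (d b c) (δ x y) (δ y z)))
    where
    interchange : ∀ p q r s → (p + q) + (r + s) ≡ (p + r) + (q + s)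
    interchange = solve-∀

  δ-step : (∀ a b k → d a b ≡ suc k → Σ A λ a' → d a a' ≡ 1 × d a' b ≡ k) →
           ∀ {m} (x y : Vec A m) k → δ x y ≡ suc k → Σ (Vec A m) λ w → δ x w ≡ 1 × δ w y ≡ k
  δ-step d-step [] [] k ()
  δ-step d-step (a ∷ x) (b ∷ y) k e with d a b in dab
  ... | zero = let (w , xw≡1 , wy≡k) = δ-step d-step x y k e in
    a ∷ w , trans (cong (_+ δ x w) (d-refl a)) xw≡1 , trans (cong (_+ δ w y) dab) wy≡k
  ... | suc k' = let (a' , aa'≡1 , a'b≡k') = d-step a b k' dab in
    a' ∷ x , trans (cong (d a a' +_) (δ-refl x)) (trans (NP.+-identityʳ _) aa'≡1) ,
             trans (cong (_+ δ x y) a'b≡k') (NP.suc-injective e)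

dist-unique : ∀ {G : Graph} {u v k k'} → Dist G u v k → Dist G u v k' → k ≡ k'
dist-unique (walk , shortest) (walk' , shortest') = NP.≤-antisym (shortest _ walk') (shortest' _ walk)

walk-zero : ∀ {G : Graph} {u v} → Walk G u v 0 → u ≡ v
walk-zero (nil _) = refl

record GraphMetric (H : Graph) : Set where
  field
    ρ          : V H → V H → ℕ
    ρ-refl     : ∀ x → ρ x x ≡ 0
    ρ-zero     : ∀ x y → ρ x y ≡ 0 → x ≡ y
    ρ-triangle : ∀ x w y → ρ x y ≤ ρ x w + ρ w y
    ρ-edge     : ∀ x w → E H x w → ρ x w ≡ 1
    ρ-step     : ∀ x y k → ρ x y ≡ suc k → Σ (V H) λ w → E H x w × ρ w y ≡ k

module _ {H : Graph} (M : GraphMetric H) where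
  open GraphMetric M

  ρ≤walk : ∀ {x y k} → Walk H x y k → ρ x y ≤ k
  ρ≤walk (nil x) = NP.≤-reflexive (ρ-refl x)
  ρ≤walk (cons {x} {w} {y} e walk) =
    NP.≤-trans (ρ-triangle x w y) (subst (λ z → z + ρ w y ≤ suc _) (sym (ρ-edge x w e)) (s≤s (ρ≤walk walk)))

  geodesic : ∀ k x y → ρ x y ≡ k → Walk H x y k
  geodesic zero x y e = subst (λ z → Walk H x z 0) (ρ-zero x y e) (nil x)
  geodesic (suc k) x y e = let (w , edge , wy≡k) = ρ-step x y k e in cons edge (geodesic k w y wy≡k)

  ρ-is-distance : ∀ x y → Dist H x y (ρ x y)
  ρ-is-distance x y = geodesic _ x y refl , λ m walk → ρ≤walk walk

  isometric⇔ : (G : Graph) (f : V G → V H) →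
               IsometricEmbedding G H f ⇔ (∀ u v → Dist G u v (ρ (f u) (f v)))
  isometric⇔ G f = mk⇔ (λ (_ , iso) u v → Equivalence.from (iso u v _) (ρ-is-distance (f u) (f v)))
                       (λ preserves → (λ {u v} → injective preserves {u} {v}) , isometric preserves)
    where
    module _ (preserves : ∀ u v → Dist G u v (ρ (f u) (f v))) where
      injective : Injective _≡_ _≡_ f
      injective {u} {v} fu≡fv =
        walk-zero (proj₁ (subst (Dist G u v) (trans (cong (ρ (f u)) (sym fu≡fv)) (ρ-refl (f u))) (preserves u v)))
      isometric : ∀ u v k → Dist G u v k ⇔ Dist H (f u) (f v) k
      isometric u v k =
        mk⇔ (λ D → subst (Dist H (f u) (f v)) (dist-unique (preserves u v) D) (ρ-is-distance (f u) (f v)))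
            (λ D → subst (Dist G u v) (dist-unique (ρ-is-distance (f u) (f v)) D) (preserves u v))

dB : Bool → Bool → ℕ
dB true true = 0
dB true false = 1
dB false true = 1
dB false false = 0

dB-refl : ∀ a → dB a a ≡ 0
dB-refl true = refl
dB-refl false = refl

dB-zero : ∀ a b → dB a b ≡ 0 → a ≡ b
dB-zero true true _ = refl
dB-zero false false _ = refl

dB-differ : ∀ {a b} → a ≢ b → dB a b ≡ 1
dB-differ {true} {true} a≢b = ⊥-elim (a≢b refl)
dB-differ {true} {false} _ = refl
dB-differ {false} {true} _ = refl
dB-differ {false} {false} a≢b = ⊥-elim (a≢b refl)

dB-triangle : ∀ a b c → dB a c ≤ dB a b + dB b c
dB-triangle true true c = NP.≤-refl
dB-triangle false false c = NP.≤-refl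
dB-triangle true false true = z≤n
dB-triangle true false false = NP.≤-refl
dB-triangle false true true = NP.≤-refl
dB-triangle false true false = z≤n

dB-step : ∀ a b k → dB a b ≡ suc k → Σ Bool λ a' → dB a a' ≡ 1 × dB a' b ≡ k
dB-step true false k e = false , refl , NP.suc-injective e
dB-step false true k e = true , refl , NP.suc-injective e

module Hamming = SumMetric dB dB-refl dB-zero
open Hamming using () renaming (δ to δB)

adjacent⇒δB≡1 : ∀ {m} (x y : Vec Bool m) → HypercubeAdj x y → δB x y ≡ 1
adjacent⇒δB≡1 x y (j , x≢y , agree) = trans (Hamming.agree-off-distance x y j agree) (dB-differ x≢y)

δB≡1⇒adjacent : ∀ {m} (x y : Vec Bool m) → δB x y ≡ 1 → HypercubeAdj x y
δB≡1⇒adjacent x y e = let (j , x≢y) = Hamming.differing-coordinate x y e in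
  j , x≢y , Hamming.unit-distance-agree x y j e x≢y

Q-metric : ∀ d → GraphMetric (Q d)
Q-metric d = record
  { ρ = δB ; ρ-refl = Hamming.δ-refl ; ρ-zero = Hamming.δ-zero
  ; ρ-triangle = Hamming.δ-triangle dB-triangle ; ρ-edge = adjacent⇒δB≡1
  ; ρ-step = λ x y k e → let (w , xw≡1 , wy≡k) = Hamming.δ-step dB-step x y k e in
                         w , δB≡1⇒adjacent x w xw≡1 , wy≡k }

dZ : ℤ → ℤ → ℕ
dZ a b = Z.∣ a Z.- b ∣

dZ-refl : ∀ a → dZ a a ≡ 0
dZ-refl a = cong Z.∣_∣ (ZP.+-inverseʳ a)

dZ-zero : ∀ a b → dZ a b ≡ 0 → a ≡ b
dZ-zero a b e = ZP.i-j≡0⇒i≡j a b (ZP.∣i∣≡0⇒i≡0 e)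

dZ-triangle : ∀ a b c → dZ a c ≤ dZ a b + dZ b c
dZ-triangle a b c =
  subst (λ z → Z.∣ z ∣ ≤ dZ a b + dZ b c) (sym (telescope a b c)) (ZP.∣i+j∣≤∣i∣+∣j∣ (a Z.- b) (b Z.- c))
  where
  telescope : ∀ a b c → a Z.- c ≡ (a Z.- b) Z.+ (b Z.- c)
  telescope = ℤ-solve-∀

dZ-step : ∀ a b k → dZ a b ≡ suc k → Σ ℤ λ a' → dZ a a' ≡ 1 × dZ a' b ≡ k
dZ-step a b k e with a Z.- b in a-b
... | Z.+ (suc k') = a Z.- Z.+ 1 , cong Z.∣_∣ (unit a) , (begin
    Z.∣ (a Z.- Z.+ 1) Z.- b ∣   ≡⟨ cong Z.∣_∣ (trans (shift a b) (cong (Z._- Z.+ 1) a-b)) ⟩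
    Z.∣ suc k' Z.⊖ 1 ∣           ≡⟨ cong Z.∣_∣ (ZP.⊖-≥ (s≤s z≤n)) ⟩
    k'                           ≡⟨ NP.suc-injective e ⟩
    k                            ∎)
  where
  open ≡-Reasoning
  unit : ∀ a → a Z.- (a Z.- Z.+ 1) ≡ Z.+ 1
  unit = ℤ-solve-∀
  shift : ∀ a b → (a Z.- Z.+ 1) Z.- b ≡ (a Z.- b) Z.- Z.+ 1
  shift = ℤ-solve-∀
... | Z.-[1+ k' ] = a Z.+ Z.+ 1 , trans (cong Z.∣_∣ (unit a)) (ZP.∣-i∣≡∣i∣ (Z.+ 1)) , (begin
    Z.∣ (a Z.+ Z.+ 1) Z.- b ∣   ≡⟨ cong Z.∣_∣ (trans (shift a b) (cong (Z._+ Z.+ 1) a-b)) ⟩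
    Z.∣ 1 Z.⊖ suc k' ∣           ≡⟨ ZP.∣⊖∣-≤ (s≤s z≤n) ⟩
    k'                           ≡⟨ NP.suc-injective e ⟩
    k                            ∎)
  where
  open ≡-Reasoning
  unit : ∀ a → a Z.- (a Z.+ Z.+ 1) ≡ Z.- Z.+ 1
  unit = ℤ-solve-∀
  shift : ∀ a b → (a Z.+ Z.+ 1) Z.- b ≡ (a Z.- b) Z.+ Z.+ 1
  shift = ℤ-solve-∀

module Taxicab = SumMetric dZ dZ-refl dZ-zero
open Taxicab using () renaming (δ to δZ)

l1≡δZ : ∀ {m} (x y : Vec ℤ m) → l1 x y ≡ δZ x y
l1≡δZ [] [] = refl
l1≡δZ (a ∷ x) (b ∷ y) = cong (dZ a b +_) (l1≡δZ x y)

ZZ-metric : ∀ ℓ → GraphMetric (ZZ ℓ)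
ZZ-metric ℓ = record
  { ρ = δZ ; ρ-refl = Taxicab.δ-refl ; ρ-zero = Taxicab.δ-zero
  ; ρ-triangle = Taxicab.δ-triangle dZ-triangle
  ; ρ-edge = λ x w e → trans (sym (l1≡δZ x w)) e
  ; ρ-step = λ x y k e → let (w , xw≡1 , wy≡k) = Taxicab.δ-step dZ-step x y k e in
                         w , trans (l1≡δZ x w) xw≡1 , wy≡k }

module Manhattan = SumMetric ∣_-_∣ NP.∣n-n∣≡0 (λ a b → NP.∣m-n∣≡0⇒m≡n)
open Manhattan using () renaming (δ to δN)

data _⊑_ : ∀ {m} → Vec Bool m → Vec Bool m → Set where
  []⊑ : [] ⊑ []
  0⊑  : ∀ {m b} {x y : Vec Bool m} → x ⊑ y → (false ∷ x) ⊑ (b ∷ y)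
  1⊑  : ∀ {m} {x y : Vec Bool m} → x ⊑ y → (true ∷ x) ⊑ (true ∷ y)

⊑-refl : ∀ {m} (x : Vec Bool m) → x ⊑ x
⊑-refl [] = []⊑
⊑-refl (true ∷ x) = 1⊑ (⊑-refl x)
⊑-refl (false ∷ x) = 0⊑ (⊑-refl x)

fib-0∷ : ∀ {m} (x : Vec Bool m) → T (isFib x) → T (isFib (false ∷ x))
fib-0∷ [] _ = tt
fib-0∷ (b ∷ x) fib = fib

fib-tail : ∀ {m} b (x : Vec Bool m) → T (isFib (b ∷ x)) → T (isFib x)
fib-tail b [] _ = tt
fib-tail true (false ∷ x) fib = fib
fib-tail false (b ∷ x) fib = fib

fib-⊑ : ∀ {m} {x y : Vec Bool m} → x ⊑ y → T (isFib y) → T (isFib x)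
fib-⊑ []⊑ _ = tt
fib-⊑ (0⊑ {b = b} {x} {y} x⊑y) fib = fib-0∷ x (fib-⊑ x⊑y (fib-tail b y fib))
fib-⊑ (1⊑ []⊑) _ = tt
fib-⊑ (1⊑ (0⊑ {b = false} {x} {y} x⊑y)) fib = fib-0∷ x (fib-⊑ x⊑y (fib-tail false y fib))
fib-⊑ (1⊑ (1⊑ x⊑y)) ()

fib-++ : ∀ {m k} (x : Vec Bool m) (y : Vec Bool k) → T (isFib x) → T (isFib y) →
         T (isFib (x V.++ (false ∷ y)))
fib-++ [] y _ fy = fib-0∷ y fy
fib-++ (true ∷ []) y _ fy = fib-0∷ y fy
fib-++ (false ∷ []) y _ fy = fib-0∷ y fy
fib-++ (true ∷ false ∷ x) y fx fy = fib-++ (false ∷ x) y fx fy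
fib-++ (false ∷ b ∷ x) y fx fy = fib-++ (b ∷ x) y fx fy

fib-≡ : ∀ {d} (x y : FibString d) → proj₁ x ≡ proj₁ y → x ≡ y
fib-≡ (x , p) (.x , q) refl = cong (x ,_) (BP.T-irrelevant p q)

-- A geodesic step in Q_m from x towards y can be taken to a string below x or below y;
-- this keeps Fibonacci cubes geodesically closed inside hypercubes.
fibonacci-step : ∀ {m} (x y : Vec Bool m) k → δB x y ≡ suc k →
                 Σ (Vec Bool m) λ w → δB x w ≡ 1 × δB w y ≡ k × (w ⊑ x ⊎ w ⊑ y)
fibonacci-step [] [] k ()
fibonacci-step (true ∷ x) (false ∷ y) k e =
  false ∷ x , cong suc (Hamming.δ-refl x) , NP.suc-injective e , inj₁ (0⊑ (⊑-refl x))
fibonacci-step (false ∷ x) (true ∷ y) k e with δB x y in xy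
... | zero = true ∷ x , cong suc (Hamming.δ-refl x) , trans xy (NP.suc-injective e) ,
             inj₂ (1⊑ (subst (x ⊑_) (Hamming.δ-zero x y xy) (⊑-refl x)))
... | suc k' = let (w , xw≡1 , wy≡k' , below) = fibonacci-step x y k' xy in
  false ∷ w , xw≡1 , trans (cong suc wy≡k') (NP.suc-injective e) , Data.Sum.map 0⊑ 0⊑ below
fibonacci-step (true ∷ x) (true ∷ y) k e = let (w , xw≡1 , wy≡k , below) = fibonacci-step x y k e in
  true ∷ w , xw≡1 , wy≡k , Data.Sum.map 1⊑ 1⊑ below
fibonacci-step (false ∷ x) (false ∷ y) k e = let (w , xw≡1 , wy≡k , below) = fibonacci-step x y k e in
  false ∷ w , xw≡1 , wy≡k , Data.Sum.map 0⊑ 0⊑ below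

Γ-metric : ∀ d → GraphMetric (Γ d)
Γ-metric d = record
  { ρ = λ x y → δB (proj₁ x) (proj₁ y)
  ; ρ-refl = λ x → Hamming.δ-refl (proj₁ x)
  ; ρ-zero = λ x y e → fib-≡ x y (Hamming.δ-zero _ _ e)
  ; ρ-triangle = λ x w y → Hamming.δ-triangle dB-triangle (proj₁ x) (proj₁ w) (proj₁ y)
  ; ρ-edge = λ x w → adjacent⇒δB≡1 (proj₁ x) (proj₁ w)
  ; ρ-step = step }
  where
  step : ∀ (x y : FibString d) k → δB (proj₁ x) (proj₁ y) ≡ suc k →
         Σ (FibString d) λ w → HypercubeAdj (proj₁ x) (proj₁ w) × δB (proj₁ w) (proj₁ y) ≡ k
  step (x , fx) (y , fy) k e with fibonacci-step x y k e
  ... | w , xw≡1 , wy≡k , inj₁ w⊑x = (w , fib-⊑ w⊑x fx) , δB≡1⇒adjacent x w xw≡1 , wy≡k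
  ... | w , xw≡1 , wy≡k , inj₂ w⊑y = (w , fib-⊑ w⊑y fy) , δB≡1⇒adjacent x w xw≡1 , wy≡k

-- The path 0 — 1 — ⋯ — a embeds isometrically into Γ_a by a reflected code:
-- 0 ↦ 1 c_{a-1}(a-1) and 1+x ↦ 0 c_{a-1}(a-1-x).
path-code : (a : ℕ) → ℕ → Vec Bool a
path-code zero x = []
path-code (suc a) zero = true ∷ path-code a a
path-code (suc a) (suc x) = false ∷ path-code a (a ∸ x)

path-code-fib : ∀ a x → T (isFib (path-code a x))
path-code-fib zero x = tt
path-code-fib (suc zero) zero = tt
path-code-fib (suc (suc a)) zero = fib-0∷ (path-code a (a ∸ a)) (path-code-fib a (a ∸ a))
path-code-fib (suc a) (suc x) = fib-0∷ (path-code a (a ∸ x)) (path-code-fib a (a ∸ x))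

reflect-distance : ∀ a x y → x ≤ a → y ≤ a → ∣ a ∸ x - a ∸ y ∣ ≡ ∣ x - y ∣
reflect-distance a x y x≤a y≤a = begin
  ∣ a ∸ x - a ∸ y ∣                          ≡⟨ NP.∣m+n-m+o∣≡∣n-o∣ (x + y) (a ∸ x) (a ∸ y) ⟨
  ∣ (x + y) + (a ∸ x) - (x + y) + (a ∸ y) ∣  ≡⟨ cong₂ ∣_-_∣ (restore x y x≤a) (restore' y≤a) ⟩
  ∣ y + a - x + a ∣                          ≡⟨ cong₂ ∣_-_∣ (NP.+-comm y a) (NP.+-comm x a) ⟩
  ∣ a + y - a + x ∣                          ≡⟨ NP.∣m+n-m+o∣≡∣n-o∣ a y x ⟩
  ∣ y - x ∣                                  ≡⟨ NP.∣-∣-comm y x ⟩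
  ∣ x - y ∣                                  ∎
  where
  open ≡-Reasoning
  restore : ∀ x y → x ≤ a → (x + y) + (a ∸ x) ≡ y + a
  restore x y x≤a = trans (cong (_+ (a ∸ x)) (NP.+-comm x y))
    (trans (NP.+-assoc y x (a ∸ x)) (cong (y +_) (NP.m+[n∸m]≡n x≤a)))
  restore' : y ≤ a → (x + y) + (a ∸ y) ≡ x + a
  restore' y≤a = trans (cong (_+ (a ∸ y)) (NP.+-comm x y)) (restore y x y≤a)

path-code-distance : ∀ a x y → x ≤ a → y ≤ a → δB (path-code a x) (path-code a y) ≡ ∣ x - y ∣
path-code-distance zero zero zero _ _ = refl
path-code-distance (suc a) zero zero _ _ = Hamming.δ-refl (path-code a a)
path-code-distance (suc a) zero (suc y) _ (s≤s y≤a) = cong suc (begin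
  δB (path-code a a) (path-code a (a ∸ y)) ≡⟨ path-code-distance a a (a ∸ y) NP.≤-refl (NP.m∸n≤m a y) ⟩
  ∣ a - a ∸ y ∣                            ≡⟨ NP.m≤n⇒∣n-m∣≡n∸m (NP.m∸n≤m a y) ⟩
  a ∸ (a ∸ y)                              ≡⟨ NP.m∸[m∸n]≡n y≤a ⟩
  y                                        ∎)
  where open ≡-Reasoning
path-code-distance (suc a) (suc x) zero (s≤s x≤a) _ = cong suc (begin
  δB (path-code a (a ∸ x)) (path-code a a) ≡⟨ path-code-distance a (a ∸ x) a (NP.m∸n≤m a x) NP.≤-refl ⟩
  ∣ a ∸ x - a ∣                            ≡⟨ NP.m≤n⇒∣m-n∣≡n∸m (NP.m∸n≤m a x) ⟩
  a ∸ (a ∸ x)                              ≡⟨ NP.m∸[m∸n]≡n x≤a ⟩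
  x                                        ∎)
  where open ≡-Reasoning
path-code-distance (suc a) (suc x) (suc y) (s≤s x≤a) (s≤s y≤a) =
  trans (path-code-distance a (a ∸ x) (a ∸ y) (NP.m∸n≤m a x) (NP.m∸n≤m a y)) (reflect-distance a x y x≤a y≤a)

box-dim : ∀ {ℓ} → Vec ℕ ℓ → ℕ
box-dim [] = 0
box-dim (a ∷ []) = a
box-dim (a ∷ b ∷ as) = a + suc (box-dim (b ∷ as))

box-code : ∀ {ℓ} (as : Vec ℕ ℓ) → Vec ℕ ℓ → Vec Bool (box-dim as)
box-code [] [] = []
box-code (a ∷ []) (p ∷ []) = path-code a p
box-code (a ∷ b ∷ as) (p ∷ ps) = path-code a p V.++ (false ∷ box-code (b ∷ as) ps)

box-code-fib : ∀ {ℓ} (as ps : Vec ℕ ℓ) → T (isFib (box-code as ps))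
box-code-fib [] [] = tt
box-code-fib (a ∷ []) (p ∷ []) = path-code-fib a p
box-code-fib (a ∷ b ∷ as) (p ∷ ps) =
  fib-++ (path-code a p) (box-code (b ∷ as) ps) (path-code-fib a p) (box-code-fib (b ∷ as) ps)

δB-++ : ∀ {m k} (x x' : Vec Bool m) (y y' : Vec Bool k) → δB (x V.++ y) (x' V.++ y') ≡ δB x x' + δB y y'
δB-++ [] [] y y' = refl
δB-++ (a ∷ x) (b ∷ x') y y' = trans (cong (dB a b +_) (δB-++ x x' y y')) (sym (NP.+-assoc (dB a b) _ _))

InBox : ∀ {ℓ} → Vec ℕ ℓ → Vec ℕ ℓ → Set
InBox as ps = ∀ k → lookup ps k ≤ lookup as k

box-code-distance : ∀ {ℓ} (as ps qs : Vec ℕ ℓ) → InBox as ps → InBox as qs →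
                    δB (box-code as ps) (box-code as qs) ≡ δN ps qs
box-code-distance [] [] [] _ _ = refl
box-code-distance (a ∷ []) (p ∷ []) (q ∷ []) p∈ q∈ =
  trans (path-code-distance a p q (p∈ F.zero) (q∈ F.zero)) (sym (NP.+-identityʳ _))
box-code-distance (a ∷ b ∷ as) (p ∷ ps) (q ∷ qs) p∈ q∈ =
  trans (δB-++ (path-code a p) (path-code a q) (false ∷ box-code (b ∷ as) ps) (false ∷ box-code (b ∷ as) qs))
        (cong₂ _+_ (path-code-distance a p q (p∈ F.zero) (q∈ F.zero))
                   (box-code-distance (b ∷ as) ps qs (λ k → p∈ (F.suc k)) (λ k → q∈ (F.suc k))))

box-dim≡ : ∀ {ℓ} (as : Vec ℕ (suc ℓ)) → box-dim as ≡ V.sum as + ℓ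
box-dim≡ (a ∷ []) = sym (trans (NP.+-identityʳ _) (NP.+-identityʳ a))
box-dim≡ {suc ℓ} (a ∷ b ∷ as) =
  trans (cong (λ z → a + suc z) (box-dim≡ (b ∷ as))) (regroup a (V.sum (b ∷ as)) ℓ)
  where
  regroup : ∀ a s ℓ → a + suc (s + ℓ) ≡ (a + s) + suc ℓ
  regroup = solve-∀

box-dim≤ : ∀ {ℓ} (as : Vec ℕ ℓ) i → V.sum as ≤ i → box-dim as ≤ i + ℓ ∸ 1
box-dim≤ [] i _ = z≤n
box-dim≤ {suc ℓ} as i sum≤i = subst (box-dim as ≤_) (sym (cong (_∸ 1) (NP.+-suc i ℓ)))
  (subst (_≤ i + ℓ) (sym (box-dim≡ as)) (NP.+-monoˡ-≤ ℓ sum≤i))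

∣t-1+s∣≡1+∣t-s∣ : ∀ {t s} → t ≤ s → ∣ t - suc s ∣ ≡ suc ∣ t - s ∣
∣t-1+s∣≡1+∣t-s∣ {t} {s} t≤s = begin
  ∣ t - suc s ∣  ≡⟨ NP.m≤n⇒∣m-n∣≡n∸m (NP.m≤n⇒m≤1+n t≤s) ⟩
  suc s ∸ t      ≡⟨ NP.+-∸-assoc 1 t≤s ⟩
  suc (s ∸ t)    ≡⟨ cong suc (NP.m≤n⇒∣m-n∣≡n∸m t≤s) ⟨
  suc ∣ t - s ∣  ∎
  where open ≡-Reasoning

∣t-s∣≡1+∣t-1+s∣ : ∀ {t s} → s < t → ∣ t - s ∣ ≡ suc ∣ t - suc s ∣
∣t-s∣≡1+∣t-1+s∣ {t} {s} s<t = begin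
  ∣ t - s ∣        ≡⟨ NP.m≤n⇒∣n-m∣≡n∸m (NP.<⇒≤ s<t) ⟩
  t ∸ s            ≡⟨ NP.+-∸-assoc 1 s<t ⟩
  suc (t ∸ suc s)  ≡⟨ cong suc (NP.m≤n⇒∣n-m∣≡n∸m s<t) ⟨
  suc ∣ t - suc s ∣ ∎
  where open ≡-Reasoning

separated : ∀ {W : Set} (Q : W → Set) (label : W → Bool) b → (∀ w → Q w ⇔ (label w ≡ b)) →
            ∀ {x y} → label x ≢ label y → ¬ (Q x ⇔ Q y)
separated Q label b char {x} {y} x≢y Qx⇔Qy with label x BP.≟ b
... | yes x≡b = x≢y (trans x≡b (sym (Equivalence.to (char y) (Equivalence.to Qx⇔Qy (Equivalence.from (char x) x≡b)))))
... | no x≢b = x≢y (bool-others-agree x≢b y≢b)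
  where
  y≢b : label y ≢ b
  y≢b y≡b = x≢b (Equivalence.to (char x) (Equivalence.from Qx⇔Qy (Equivalence.from (char y) y≡b)))

-- Fin (Σₖ aₖ) enumerates the slots (k, s) with s < aₖ.
Slot : ∀ {ℓ} → Vec ℕ ℓ → Set
Slot {ℓ} as = Σ (Fin ℓ) λ k → Fin (lookup as k)

slot : ∀ {ℓ} (as : Vec ℕ ℓ) → Fin (V.sum as) → Slot as
slot (a ∷ as) i with F.splitAt a i
... | inj₁ s = F.zero , s
... | inj₂ r = let (k , s) = slot as r in F.suc k , s

slot-index : ∀ {ℓ} (as : Vec ℕ ℓ) → Slot as → Fin (V.sum as)
slot-index (a ∷ as) (F.zero , s) = s F.↑ˡ V.sum as
slot-index (a ∷ as) (F.suc k , s) = a F.↑ʳ slot-index as (k , s)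

slot-index-slot : ∀ {ℓ} (as : Vec ℕ ℓ) i → slot-index as (slot as i) ≡ i
slot-index-slot (a ∷ as) i with F.splitAt a i in split
... | inj₁ s = trans (cong (F.join a _) (sym split)) (FP.join-splitAt a _ i)
... | inj₂ r = trans (cong (a F.↑ʳ_) (slot-index-slot as r))
                     (trans (cong (F.join a _) (sym split)) (FP.join-splitAt a _ i))

slots≤ : ∀ {ℓ i} (as : Vec ℕ ℓ) (f : Slot as → Fin i) → (∀ p q → f p ≡ f q → p ≡ q) → V.sum as ≤ i
slots≤ as f f-inj = FP.injective⇒≤ {f = λ r → f (slot as r)} λ {r} {r'} e → begin
  r                          ≡⟨ slot-index-slot as r ⟨
  slot-index as (slot as r)  ≡⟨ cong (slot-index as) (f-inj _ _ e) ⟩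
  slot-index as (slot as r') ≡⟨ slot-index-slot as r' ⟩
  r'                         ∎
  where open ≡-Reasoning

-- Two labellings of N vertices, H into Q_i and P into ℕ^ℓ, inducing the same distances
-- (as two isometric embeddings of one graph do).
module Crossings {N i ℓ : ℕ} (H : Fin N → Vec Bool i) (P : Fin N → Vec ℕ ℓ)
                 (same-distance : ∀ u v → δB (H u) (H v) ≡ δN (P u) (P v)) where

  record Crossing (k : Fin ℓ) (s : ℕ) : Set where
    field
      x y  : Fin N
      unit : δN (P x) (P y) ≡ 1
      x-at : lookup (P x) k ≡ s
      y-at : lookup (P y) k ≡ suc s

  module _ {k : Fin ℓ} {s : ℕ} (c : Crossing k s) where
    open Crossing c

    private
      unitH : δB (H x) (H y) ≡ 1
      unitH = trans (same-distance x y) unit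

    flipped : Fin i
    flipped = proj₁ (Hamming.differing-coordinate (H x) (H y) unitH)

    flipped-differs : lookup (H x) flipped ≢ lookup (H y) flipped
    flipped-differs = proj₂ (Hamming.differing-coordinate (H x) (H y) unitH)

    P-agree : Manhattan.AgreeOff k (P x) (P y)
    P-agree = Manhattan.unit-distance-agree (P x) (P y) k unit
      (λ e → NP.1+n≰n (NP.≤-reflexive (trans (sym y-at) (trans (sym e) x-at))))

    private
      H-agree : Hamming.AgreeOff flipped (H x) (H y)
      H-agree = Hamming.unit-distance-agree (H x) (H y) flipped unitH flipped-differs

      below⇒nearer-x : ∀ w → lookup (P w) k ≤ s → δN (P w) (P y) ≡ suc (δN (P w) (P x))
      below⇒nearer-x w t≤s = Manhattan.nearer (P w) (P x) (P y) k P-agree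
        (subst₂ (λ a b → ∣ lookup (P w) k - b ∣ ≡ suc ∣ lookup (P w) k - a ∣) (sym x-at) (sym y-at)
                (∣t-1+s∣≡1+∣t-s∣ t≤s))

      above⇒nearer-y : ∀ w → s < lookup (P w) k → δN (P w) (P x) ≡ suc (δN (P w) (P y))
      above⇒nearer-y w s<t = Manhattan.nearer (P w) (P y) (P x) k (λ j j≢k → sym (P-agree j j≢k))
        (subst₂ (λ a b → ∣ lookup (P w) k - a ∣ ≡ suc ∣ lookup (P w) k - b ∣) (sym x-at) (sym y-at)
                (∣t-s∣≡1+∣t-1+s∣ s<t))

      bit-nearer : ∀ w (a b : Fin N) → Hamming.AgreeOff flipped (H a) (H b) →
                   lookup (H w) flipped ≡ lookup (H a) flipped → lookup (H a) flipped ≢ lookup (H b) flipped →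
                   δN (P w) (P b) ≡ suc (δN (P w) (P a))
      bit-nearer w a b agree w≡a a≢b = subst₂ (λ p q → p ≡ suc q) (same-distance w b) (same-distance w a)
        (Hamming.nearer (H w) (H a) (H b) flipped agree
          (trans (dB-differ (λ e → a≢b (trans (sym w≡a) e)))
                 (cong suc (sym (trans (cong (λ z → dB z _) w≡a) (dB-refl _))))))

      same-bit⇒nearer-x : ∀ w → lookup (H w) flipped ≡ lookup (H x) flipped → δN (P w) (P y) ≡ suc (δN (P w) (P x))
      same-bit⇒nearer-x w w≡x = bit-nearer w x y H-agree w≡x flipped-differs

      other-bit⇒nearer-y : ∀ w → lookup (H w) flipped ≢ lookup (H x) flipped → δN (P w) (P x) ≡ suc (δN (P w) (P y))
      other-bit⇒nearer-y w w≢x = bit-nearer w y x (λ j j≢k → sym (H-agree j j≢k))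
        (bool-others-agree w≢x (λ e → flipped-differs (sym e))) (λ e → flipped-differs (sym e))

    halfspace : ∀ w → (lookup (P w) k ≤ s) ⇔ (lookup (H w) flipped ≡ lookup (H x) flipped)
    halfspace w = mk⇔ to from
      where
      to : lookup (P w) k ≤ s → lookup (H w) flipped ≡ lookup (H x) flipped
      to t≤s with lookup (H w) flipped BP.≟ lookup (H x) flipped
      ... | yes same = same
      ... | no other = ⊥-elim (not-mutual-successors (below⇒nearer-x w t≤s) (other-bit⇒nearer-y w other))
      from : lookup (H w) flipped ≡ lookup (H x) flipped → lookup (P w) k ≤ s
      from same with lookup (P w) k NP.≤? s
      ... | yes t≤s = t≤s
      ... | no t≰s = ⊥-elim (not-mutual-successors (same-bit⇒nearer-x w same) (above⇒nearer-y w (NP.≰⇒> t≰s)))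

  flipped-injective : ∀ {k k' s s'} (c : Crossing k s) (c' : Crossing k' s') →
                      flipped c ≡ flipped c' → k ≡ k' × s ≡ s'
  flipped-injective {k} {k'} {s} {s'} c c' same-flip = k≡k' , threshold s s' s-separated
    where
    open Crossing c
    -- c's edge has different bits at c''s flipped coordinate, so c''s halfspace separates it.
    edge-separated : ¬ ((lookup (P x) k' ≤ s') ⇔ (lookup (P y) k' ≤ s'))
    edge-separated = separated (λ w → lookup (P w) k' ≤ s') (λ w → lookup (H w) (flipped c'))
      (lookup (H (Crossing.x c')) (flipped c')) (halfspace c')
      (subst (λ j → lookup (H x) j ≢ lookup (H y) j) same-flip (flipped-differs c))
    k≡k' : k ≡ k'
    k≡k' with k' F.≟ k
    ... | yes k'≡k = sym k'≡k
    ... | no k'≢k = ⊥-elim (edge-separated (subst (λ t → (lookup (P x) k' ≤ s') ⇔ (t ≤ s'))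
                                                  (P-agree c k' k'≢k) (mk⇔ (λ p → p) (λ p → p))))
    s-separated : ¬ ((s ≤ s') ⇔ (suc s ≤ s'))
    s-separated = subst₂ (λ a b → ¬ ((a ≤ s') ⇔ (b ≤ s')))
      (trans (cong (lookup (P x)) (sym k≡k')) x-at) (trans (cong (lookup (P y)) (sym k≡k')) y-at) edge-separated

  crossings≤ : (as : Vec ℕ ℓ) → (∀ k (s : Fin (lookup as k)) → Crossing k (F.toℕ s)) → V.sum as ≤ i
  crossings≤ as crossing = slots≤ as (λ (k , s) → flipped (crossing k s)) injective
    where
    injective : ∀ p q → flipped (crossing (proj₁ p) (proj₂ p)) ≡ flipped (crossing (proj₁ q) (proj₂ q)) → p ≡ q
    injective (k , s) (k' , s') e with flipped-injective (crossing k s) (crossing k' s') e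
    ... | refl , s≡s' = cong (k ,_) (FP.toℕ-injective s≡s')

argmin : ∀ {N} → Fin N → (Fin N → ℤ) → Fin N
argmin u₀ f = ℤ-Extrema.argmin f u₀ (allFin _)

argmin-≤ : ∀ {N} (u₀ : Fin N) (f : Fin N → ℤ) u → f (argmin u₀ f) Z.≤ f u
argmin-≤ u₀ f u = All.lookup (ℤ-Extrema.f[argmin]≤f[xs] u₀ (allFin _)) (∈-allFin u)

argmax : ∀ {N} → Fin N → (Fin N → ℕ) → Fin N
argmax u₀ f = ℕ-Extrema.argmax f u₀ (allFin _)

argmax-≥ : ∀ {N} (u₀ : Fin N) (f : Fin N → ℕ) u → f u ≤ f (argmax u₀ f)
argmax-≥ u₀ f u = All.lookup (ℕ-Extrema.f[xs]≤f[argmax] u₀ (allFin _)) (∈-allFin u)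

∣⊖∣≡∣-∣ : ∀ p q → Z.∣ p Z.⊖ q ∣ ≡ ∣ p - q ∣
∣⊖∣≡∣-∣ p q with NP.≤-total p q
... | inj₁ p≤q = trans (ZP.∣⊖∣-≤ p≤q) (sym (NP.m≤n⇒∣m-n∣≡n∸m p≤q))
... | inj₂ q≤p = trans (ZP.∣m⊖n∣≡∣n⊖m∣ p q) (trans (ZP.∣⊖∣-≤ q≤p) (sym (NP.m≤n⇒∣n-m∣≡n∸m q≤p)))

δN≡δZ : ∀ {ℓ} (p q : Vec ℕ ℓ) (a b : Vec ℤ ℓ) →
        (∀ k → ∣ lookup p k - lookup q k ∣ ≡ dZ (lookup a k) (lookup b k)) → δN p q ≡ δZ a b
δN≡δZ [] [] [] [] _ = refl
δN≡δZ (p ∷ ps) (q ∷ qs) (a ∷ as) (b ∷ bs) same = cong₂ _+_ (same F.zero) (δN≡δZ ps qs as bs (λ k → same (F.suc k)))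

edge-distance : ∀ (G : FiniteSimpleGraph) x y → T (adj G x y) → Dist (toGraph G) x y 1
edge-distance G x y e = cons e (nil y) , shortest
  where
  shortest : ∀ m → Walk (toGraph G) x y m → 1 ≤ m
  shortest zero walk = ⊥-elim (subst T (FiniteSimpleGraph.irrefl G y) (subst (λ z → T (adj G z y)) (walk-zero walk) e))
  shortest (suc m) _ = s≤s z≤n

level-crossing : ∀ {G : Graph} (φ : V G → ℕ) → (∀ u w → E G u w → ∣ φ u - φ w ∣ ≤ 1) →
                 ∀ s {u v k} → Walk G u v k → φ u ≤ s → s < φ v →
                 Σ (V G) λ x → Σ (V G) λ y → E G x y × φ x ≡ s × φ y ≡ suc s
level-crossing φ lipschitz s (nil _) u≤s s<v = ⊥-elim (NP.<⇒≱ s<v u≤s)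
level-crossing φ lipschitz s (cons {u} {w} e walk) u≤s s<v with s NP.<? φ w
... | no w≤s = level-crossing φ lipschitz s walk (NP.≮⇒≥ w≤s) s<v
... | yes s<w = u , w , e , squeeze (φ u) (φ w) s u≤s s<w (lipschitz u w e)

module Construction (G : FiniteSimpleGraph) (u₀ : Fin (n G)) {i ℓ : ℕ}
       (h : Fin (n G) → Vec Bool i) (h-distance : ∀ u v → Dist (toGraph G) u v (δB (h u) (h v)))
       (g : Fin (n G) → Vec ℤ ℓ) (g-distance : ∀ u v → Dist (toGraph G) u v (δZ (g u) (g v))) where

  -- Translate g so that every coordinate has minimum 0: P u = g u - min.
  coordinate : Fin ℓ → Fin (n G) → ℤ
  coordinate k u = lookup (g u) k

  lowest : Fin ℓ → Fin (n G)
  lowest k = argmin u₀ (coordinate k)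

  level : Fin (n G) → Fin ℓ → ℕ
  level u k = Z.∣ coordinate k (lowest k) Z.- coordinate k u ∣

  P : Fin (n G) → Vec ℕ ℓ
  P u = V.tabulate (level u)

  level≡offset : ∀ u k → Z.+ level u k ≡ coordinate k u Z.- coordinate k (lowest k)
  level≡offset u k = ZP.∣-∣-≤ (argmin-≤ u₀ (coordinate k) u)

  level-distance : ∀ u v k → ∣ lookup (P u) k - lookup (P v) k ∣ ≡ dZ (coordinate k u) (coordinate k v)
  level-distance u v k = begin
    ∣ lookup (P u) k - lookup (P v) k ∣    ≡⟨ cong₂ ∣_-_∣ (lookup∘tabulate (level u) k) (lookup∘tabulate (level v) k) ⟩
    ∣ level u k - level v k ∣              ≡⟨ ∣⊖∣≡∣-∣ (level u k) (level v k) ⟨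
    Z.∣ level u k Z.⊖ level v k ∣          ≡⟨ cong Z.∣_∣ (ZP.[+m]-[+n]≡m⊖n (level u k) (level v k)) ⟨
    Z.∣ Z.+ level u k Z.- Z.+ level v k ∣  ≡⟨ cong Z.∣_∣ (cong₂ Z._-_ (level≡offset u k) (level≡offset v k)) ⟩
    Z.∣ (a Z.- m) Z.- (b Z.- m) ∣          ≡⟨ cong Z.∣_∣ (cancel-offset a b m) ⟩
    dZ a b                                 ∎
    where
    open ≡-Reasoning
    a = coordinate k u
    b = coordinate k v
    m = coordinate k (lowest k)
    cancel-offset : ∀ a b m → (a Z.- m) Z.- (b Z.- m) ≡ a Z.- b
    cancel-offset = ℤ-solve-∀

  same-distance : ∀ u v → δB (h u) (h v) ≡ δN (P u) (P v)
  same-distance u v = trans (dist-unique (h-distance u v) (g-distance u v))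
                            (sym (δN≡δZ (P u) (P v) (g u) (g v) (level-distance u v)))

  P-distance : ∀ u v → Dist (toGraph G) u v (δN (P u) (P v))
  P-distance u v = subst (Dist (toGraph G) u v) (same-distance u v) (h-distance u v)

  height : Fin ℓ → Fin (n G) → ℕ
  height k u = lookup (P u) k

  highest : Fin ℓ → Fin (n G)
  highest k = argmax u₀ (height k)

  top : Fin ℓ → ℕ
  top k = height k (highest k)

  as : Vec ℕ ℓ
  as = V.tabulate top

  in-box : ∀ u → InBox as (P u)
  in-box u k = subst (height k u ≤_) (sym (lookup∘tabulate top k)) (argmax-≥ u₀ (height k) u)

  lowest-level : ∀ k → height k (lowest k) ≡ 0
  lowest-level k = trans (lookup∘tabulate (level (lowest k)) k) (dZ-refl (coordinate k (lowest k)))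

  open Crossings h P same-distance

  unit-edge : ∀ x y → T (adj G x y) → δN (P x) (P y) ≡ 1
  unit-edge x y e = dist-unique (P-distance x y) (edge-distance G x y e)

  lipschitz : ∀ k u w → T (adj G u w) → ∣ height k u - height k w ∣ ≤ 1
  lipschitz k u w e = subst (∣ height k u - height k w ∣ ≤_) (unit-edge u w e) (Manhattan.coordinate≤ (P u) (P w) k)

  -- Every level step s → 1 + s below aₖ is crossed by an edge: follow a geodesic from the
  -- lowest to the highest vertex in coordinate k.
  crossing : ∀ k (s : Fin (lookup as k)) → Crossing k (F.toℕ s)
  crossing k s =
    let (x , y , e , x-at , y-at) = level-crossing (height k) (lipschitz k) (F.toℕ s)
                                      (proj₁ (P-distance (lowest k) (highest k))) lowest≤s s<highest
    in record { x = x ; y = y ; unit = unit-edge x y e ; x-at = x-at ; y-at = y-at }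
    where
    lowest≤s : height k (lowest k) ≤ F.toℕ s
    lowest≤s = subst (_≤ F.toℕ s) (sym (lowest-level k)) z≤n
    s<highest : F.toℕ s < height k (highest k)
    s<highest = subst (F.toℕ s <_) (lookup∘tabulate top k) (FP.toℕ<n s)

  dim : ℕ
  dim = box-dim as

  dim≤ : dim ≤ i + ℓ ∸ 1
  dim≤ = box-dim≤ as i (crossings≤ as crossing)

  embedding : EmbedsInto (toGraph G) (Γ dim)
  embedding = code , Equivalence.from (isometric⇔ (Γ-metric dim) (toGraph G) code) code-distance
    where
    code : Fin (n G) → FibString dim
    code u = box-code as (P u) , box-code-fib as (P u)
    code-distance : ∀ u v → Dist (toGraph G) u v (δB (box-code as (P u)) (box-code as (P v)))
    code-distance u v = subst (Dist (toGraph G) u v) (sym (box-code-distance as (P u) (P v) (in-box u) (in-box v)))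
                              (P-distance u v)

least-below : ∀ {P : ℕ → Set} → (∀ m → Dec (P m)) → ∀ k →
              (∀ m → m < k → ¬ P m) ⊎ Σ ℕ (λ m → IsLeast P m × m < k)
least-below P? zero = inj₁ (λ m ())
least-below P? (suc k) with least-below P? k
... | inj₂ (m , m-least , m<k) = inj₂ (m , m-least , NP.m<n⇒m<1+n m<k)
... | inj₁ none with P? k
...   | yes pk = inj₂ (k , (pk , λ m pm → NP.≮⇒≥ (λ m<k → none m m<k pm)) , NP.n<1+n k)
...   | no ¬pk = inj₁ none-below-1+k
  where
  none-below-1+k : ∀ m → m < suc k → ¬ _
  none-below-1+k m m<1+k with NP.m<1+n⇒m<n∨m≡n m<1+k
  ... | inj₁ m<k = none m m<k
  ... | inj₂ refl = ¬pk

least : ∀ {P : ℕ → Set} → (∀ m → Dec (P m)) → ∀ k → P k → Σ ℕ (λ m → IsLeast P m × m ≤ k)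
least P? k pk with least-below P? (suc k)
... | inj₁ none = ⊥-elim (none k (NP.n<1+n k) pk)
... | inj₂ (m , m-least , m<1+k) = m , m-least , NP.≤-pred m<1+k

Searchable : Set → Set₁
Searchable A = ∀ {P : A → Set} → (∀ a → Dec (P a)) → Dec (Σ A P)

vectors-searchable : ∀ {A} → Searchable A → ∀ N → Searchable (Vec A N)
vectors-searchable search zero P? = map′ ([] ,_) (λ { ([] , p) → p }) (P? [])
vectors-searchable search (suc N) {P} P? =
  map′ (λ (a , xs , p) → a ∷ xs , p) (λ { (a ∷ xs , p) → a , xs , p })
       (search λ a → vectors-searchable search N λ xs → P? (a ∷ xs))

-- Bit strings are searchable (Subset m is Vec Bool m), hence so are Fibonacci strings.
fib-strings-searchable : ∀ m → Searchable (FibString m)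
fib-strings-searchable m {P} P? =
  map′ (λ (x , fx , p) → (x , fx) , p) (λ ((x , fx) , p) → x , fx , p) (anySubset? fib-and-P?)
  where
  fib-and-P? : ∀ x → Dec (Σ (T (isFib x)) λ fx → P (x , fx))
  fib-and-P? x with T? (isFib x)
  ... | yes fx = map′ (fx ,_) (λ (fx' , p) → subst (λ q → P (x , q)) (BP.T-irrelevant fx' fx) p) (P? (x , fx))
  ... | no ¬fx = no (λ (fx , _) → ¬fx fx)

module Decide (G : FiniteSimpleGraph) where
  private
    GG : Graph
    GG = toGraph G

  walk? : ∀ k u v → Dec (Walk GG u v k)
  walk? zero u v = map′ (λ { refl → nil u }) walk-zero (u F.≟ v)
  walk? (suc k) u v = map′ (λ (w , e , walk) → cons e walk) (λ { (cons e walk) → _ , e , walk })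
                           (FP.any? λ w → T? (adj G u w) ×-dec walk? k w v)

  dist? : ∀ u v k → Dec (Dist GG u v k)
  dist? u v k with least-below (λ m → walk? m u v) (suc k)
  ... | inj₁ none = no (λ (walk , _) → none k (NP.n<1+n k) walk)
  ... | inj₂ (m , shortest , _) = map′ (λ { refl → shortest }) (dist-unique shortest) (m NP.≟ k)

  Realising : ∀ {m} → (Fin (n G) → FibString m) → Set
  Realising f = ∀ u v → Dist GG u v (δB (proj₁ (f u)) (proj₁ (f v)))

  embeds? : ∀ m → Dec (EmbedsInto GG (Γ m))
  embeds? m = map′ from-codes to-codes
    (vectors-searchable (fib-strings-searchable m) (n G) λ codes →
       FP.all? λ u → FP.all? λ v → dist? u v (δB (proj₁ (lookup codes u)) (proj₁ (lookup codes v))))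
    where
    isometric : ∀ f → IsometricEmbedding GG (Γ m) f ⇔ Realising f
    isometric = isometric⇔ (Γ-metric m) GG
    from-codes : Σ (Vec (FibString m) (n G)) (λ codes → Realising (lookup codes)) → EmbedsInto GG (Γ m)
    from-codes (codes , realising) = lookup codes , Equivalence.from (isometric (lookup codes)) realising
    to-codes : EmbedsInto GG (Γ m) → Σ (Vec (FibString m) (n G)) (λ codes → Realising (lookup codes))
    to-codes (f , f-iso) = V.tabulate f , λ u v →
      subst₂ (λ a b → Dist GG u v (δB (proj₁ a) (proj₁ b))) (sym (lookup∘tabulate f u)) (sym (lookup∘tabulate f v))
             (Equivalence.to (isometric f) f-iso u v)

empty-or-inhabited : ∀ N → (Fin N → ⊥) ⊎ Fin N
empty-or-inhabited zero = inj₁ (λ ())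
empty-or-inhabited (suc N) = inj₂ F.zero

small-fibonacci-embedding : (G : FiniteSimpleGraph) {i ℓ : ℕ} →
  EmbedsInto (toGraph G) (Q i) → EmbedsInto (toGraph G) (ZZ ℓ) →
  Σ ℕ λ m → EmbedsInto (toGraph G) (Γ m) × m ≤ i + ℓ ∸ 1
small-fibonacci-embedding G {i} {ℓ} (h , h-iso) (g , g-iso) with empty-or-inhabited (n G)
... | inj₁ no-vertex =
  0 , (empty , Equivalence.from (isometric⇔ (Γ-metric 0) (toGraph G) empty) (λ u → ⊥-elim (no-vertex u))) , z≤n
  where
  empty : Fin (n G) → FibString 0
  empty u = ⊥-elim (no-vertex u)
... | inj₂ u₀ = C.dim , C.embedding , C.dim≤
  where
  module C = Construction G u₀
    h (Equivalence.to (isometric⇔ (Q-metric i) (toGraph G) h) h-iso)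
    g (Equivalence.to (isometric⇔ (ZZ-metric ℓ) (toGraph G) g) g-iso)

proposition3p7 : (G : FiniteSimpleGraph) → IsPartialCube (toGraph G) →
    (i l : ℕ) → IsIdim (toGraph G) i → IsLdim (toGraph G) l →
    Σ ℕ (λ f → IsFdim (toGraph G) f × f ≤ i + l ∸ 1)
proposition3p7 G _ i l (into-Qi , _) (into-Zl , _) =
  let (m , into-Γm , m≤bound) = small-fibonacci-embedding G into-Qi into-Zl
      (f , f-least , f≤m) = least (Decide.embeds? G) m into-Γm
  in f , f-least , NP.≤-trans f≤m m≤bound
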